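{- Let $n\geqslant 5$ and let $\phi$ be an automorphism of $\text{CQ}_n$. Then $\phi$ maps odd vertices to odd vertices and even vertices to even vertices.
   Context: Two 2-bit strings $x_2x_1$ and $y_2y_1$ are pair related, written $x_2x_1\sim y_2y_1$, iff $(x_2x_1,y_2y_1)\in\{(00,00),(10,10),(01,11),(11,01)\}$. The $n$-dimensional crossed cube $\text{CQ}_n$ has as vertices all binary strings $u=u_{n-1}\ldots u_0$ of length $n$. Two vertices $u,v$ are adjacent iff there is an index $x$ with $0\leqslant x\leqslant n-1$ such that: (1) $v_x\neq u_x$; (2) if $x$ is odd, $v_{x-1}=u_{x-1}$; (3) $v_i=u_i$ for all $i>x$; (4) $u_{2i+1}u_{2i}\sim v_{2i+1}v_{2i}$ for all $0\leqslant i\leqslant\lfloor x/2\rfloor-1$. A vertex $u$ is even (resp. odd) if $u_0=0$ (resp. $u_0=1$). -}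

module Defs where

open import Data.Bool using (Bool; true; false)
open import Data.Nat using (ℕ; zero; suc; _+_; _*_; _<_; _≤_)
open import Data.Nat.Properties using (≤-trans; n≤1+n)
open import Data.Fin using (Fin; fromℕ<)
open import Data.Product using (Σ; _×_; _,_; ∃-syntax)
open import Data.Sum using (_⊎_)
open import Relation.Binary.PropositionalEquality using (_≡_; _≢_)
open import Function.Bundles using (_⤖_; Bijection)

-- A vertex of CQ_n: a binary string u = u_{n-1} ... u_0, represented as
-- the function i ↦ u_i on Fin n (bit index 0 is the least significant bit).
Vertex : ℕ → Set
Vertex n = Fin n → Bool

bit : ∀ {n} → Vertex n → (k : ℕ) → k < n → Bool
bit u k k<n = u (fromℕ< k<n)

data _∼_ : Bool × Bool → Bool × Bool → Set where
  p00 : (false , false) ∼ (false , false)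
  p10 : (true  , false) ∼ (true  , false)
  p01 : (false , true)  ∼ (true  , true)
  p11 : (true  , true)  ∼ (false , true)

record AdjAt (n : ℕ) (u v : Vertex n) (x : ℕ) : Set where
  field
    x<n   : x < n
    diff  : bit v x x<n ≢ bit u x x<n
    odd   : ∀ j → (e : x ≡ suc (2 * j)) → (p : 2 * j < n) →
            bit v (2 * j) p ≡ bit u (2 * j) p
    above : ∀ i → x < i → (p : i < n) → bit v i p ≡ bit u i p
    -- (4) u_{2i+1}u_{2i} ∼ v_{2i+1}v_{2i} for 0 ≤ i ≤ ⌊x/2⌋ - 1,
    --     i.e. for all i with 2i+2 ≤ x
    pairs : ∀ i → 2 * i + 2 ≤ x → (p : suc (2 * i) < n) →
            (bit u (suc (2 * i)) p , bit u (2 * i) (≤-trans (n≤1+n _) p))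
              ∼ (bit v (suc (2 * i)) p , bit v (2 * i) (≤-trans (n≤1+n _) p))

Adj : (n : ℕ) → Vertex n → Vertex n → Set
Adj n u v = ∃[ x ] AdjAt n u v x

Even : ∀ {n} → Vertex (suc n) → Set
Even u = u Data.Fin.zero ≡ false

Odd : ∀ {n} → Vertex (suc n) → Set
Odd u = u Data.Fin.zero ≡ true

record Automorphism (n : ℕ) : Set where
  field
    φ   : Vertex n ⤖ Vertex n
  open Bijection φ public using (to)
  field
    preserves : ∀ u v → (Adj n u v → Adj n (to u) (to v)) ×
                        (Adj n (to u) (to v) → Adj n u v)

-- Call an edge v w of CQ_n rich if it lies on two 4-cycles v w p q v whose opposite
-- vertices q differ, with p ≠ v and q ≠ w.  Automorphisms preserve rich edges, hence
-- also the property of lying on a 5-cycle of rich edges (a rich pentagon).  At an odd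
-- vertex, the 4-cycles through an edge of dimension 0 all have the same opposite vertex,
-- so such an edge is not rich; every other edge at an odd vertex leads to an odd vertex
-- and flips bit 1.  Hence a closed walk of rich edges through an odd vertex has even
-- length, and no odd vertex lies on a rich pentagon.  An even vertex u does: the pentagon
-- along dimensions 2, 3, 4, 2, 4 with its 4-cycles stays in the copy of CQ_5 spanned by
-- the lowest five bits of u, where everything is found and checked by computation.

module Submission where

open import Defs
open import Data.Bool as Bool using (Bool; true; false; not; _xor_)
open import Data.Bool.Properties using (¬-not; not-¬)
open import Data.Empty using (⊥-elim)
open import Data.Fin using (Fin; zero; suc; toℕ; #_)
open import Data.Fin.Properties using (fromℕ<-toℕ; toℕ<n; all?; any?)
open import Data.List using (head; mapMaybe; allFin)
open import Data.Maybe using (Maybe; just; from-just; _>>=_)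
open import Data.Nat using (ℕ; zero; suc; _+_; _*_; _<_; _≤_; z≤n; s≤s; s≤s⁻¹; s<s⁻¹)
open import Data.Nat.Properties
  using (<⇒≤; ≤-trans; <-≤-trans; m≤m+n; m+n≤o⇒n≤o; +-comm; *-suc; suc-injective; _<?_; ≮⇒≥)
open import Data.Product using (_×_; _,_; proj₁; proj₂)
open import Data.Vec using ([]; _∷_; lookup)
open import Function using (_∘_)
open import Function.Bundles using (Inverse)
open import Function.Properties.Bijection using (⤖⇒↔)
open import Relation.Nullary using (¬_; yes; no)
open import Relation.Nullary.Decidable using (Dec; ¬?; dec⇒maybe)
open import Relation.Binary.PropositionalEquality

_≈_ : ∀ {n} → Vertex n → Vertex n → Set
u ≈ v = ∀ i → u i ≡ v i

∼-sym : ∀ {a b} → a ∼ b → b ∼ a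
∼-sym p00 = p00
∼-sym p10 = p10
∼-sym p01 = p11
∼-sym p11 = p01

∼⇒≡xor : ∀ {a₁ a₀ b₁ b₀} → (a₁ , a₀) ∼ (b₁ , b₀) → b₀ ≡ a₀ × b₁ ≡ a₀ xor a₁
∼⇒≡xor p00 = refl , refl
∼⇒≡xor p10 = refl , refl
∼⇒≡xor p01 = refl , refl
∼⇒≡xor p11 = refl , refl

∼-xor : ∀ a₁ a₀ → (a₁ , a₀) ∼ (a₀ xor a₁ , a₀)
∼-xor false false = p00
∼-xor true  false = p10
∼-xor false true  = p01
∼-xor true  true  = p11

xor-not-xor : ∀ a b → a xor (not a xor b) ≡ not b
xor-not-xor true  b = refl
xor-not-xor false b = refl

not⁵-fixpoint-free : ∀ b → b ≢ not (not (not (not (not b))))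
not⁵-fixpoint-free false ()
not⁵-fixpoint-free true ()

module _ {n : ℕ} where

  ≈-refl : {u : Vertex n} → u ≈ u
  ≈-refl _ = refl

  ≈-sym : {u v : Vertex n} → u ≈ v → v ≈ u
  ≈-sym e i = sym (e i)

  AdjAt-resp : ∀ {u u' v v' : Vertex n} {x} → u ≈ u' → v ≈ v' → AdjAt n u v x → AdjAt n u' v' x
  AdjAt-resp eu ev a = record
    { x<n   = x<n
    ; diff  = λ e → diff (trans (ev _) (trans e (sym (eu _))))
    ; odd   = λ j e p → trans (sym (ev _)) (trans (odd j e p) (eu _))
    ; above = λ i lt p → trans (sym (ev _)) (trans (above i lt p) (eu _))
    ; pairs = λ i le p → subst₂ _∼_ (cong₂ _,_ (eu _) (eu _)) (cong₂ _,_ (ev _) (ev _)) (pairs i le p)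
    }
    where open AdjAt a

  Adj-resp : ∀ {u u' v v' : Vertex n} → u ≈ u' → v ≈ v' → Adj n u v → Adj n u' v'
  Adj-resp eu ev (x , a) = x , AdjAt-resp eu ev a

  AdjAt-sym : ∀ {u v : Vertex n} {x} → AdjAt n u v x → AdjAt n v u x
  AdjAt-sym a = record
    { x<n   = x<n
    ; diff  = λ e → diff (sym e)
    ; odd   = λ j e p → sym (odd j e p)
    ; above = λ i lt p → sym (above i lt p)
    ; pairs = λ i le p → ∼-sym (pairs i le p)
    }
    where open AdjAt a

  AdjAt-above : ∀ {u v : Vertex n} {x} → AdjAt n u v x → ∀ i → x < toℕ i → v i ≡ u i
  AdjAt-above {u} {v} a i lt =
    subst (λ j → v j ≡ u j) (fromℕ<-toℕ i (toℕ<n i)) (AdjAt.above a (toℕ i) lt (toℕ<n i))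

bit-cong : ∀ {n} (u : Vertex n) {k k'} → k ≡ k' → (p : k < n) (p' : k' < n) → bit u k p ≡ bit u k' p'
bit-cong u refl p p' = refl

drop₂ : ∀ {n} → Vertex (suc (suc n)) → Vertex n
drop₂ u i = u (suc (suc i))

AdjAt-shift : ∀ {n} {u v : Vertex (suc (suc n))} {x} →
              (u (suc zero) , u zero) ∼ (v (suc zero) , v zero) →
              AdjAt n (drop₂ u) (drop₂ v) x → AdjAt (suc (suc n)) u v (suc (suc x))
AdjAt-shift {n} {u} {v} {x} pair₀ a = record
  { x<n   = s≤s (s≤s x<n)
  ; diff  = diff
  ; odd   = odd′
  ; above = above′
  ; pairs = pairs′
  }
  where
    open AdjAt a

    odd′ : ∀ j → suc (suc x) ≡ suc (2 * j) → (p : 2 * j < suc (suc n)) → bit v (2 * j) p ≡ bit u (2 * j) p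
    odd′ zero () p
    odd′ (suc j) e p =
      trans (bit-cong v (*-suc 2 j) p p′)
        (trans (odd j (suc-injective (trans (suc-injective e) (*-suc 2 j))) q) (bit-cong u (sym (*-suc 2 j)) p′ p))
      where
        p′ = subst (_< suc (suc n)) (*-suc 2 j) p
        q  = s<s⁻¹ (s<s⁻¹ p′)

    above′ : ∀ i → suc (suc x) < i → (p : i < suc (suc n)) → bit v i p ≡ bit u i p
    above′ (suc (suc i)) (s≤s (s≤s lt)) (s≤s (s≤s p)) = above i lt p

    pairs′ : ∀ i → 2 * i + 2 ≤ suc (suc x) → (p : suc (2 * i) < suc (suc n)) →
              (bit u (suc (2 * i)) p , bit u (2 * i) (<⇒≤ p)) ∼
              (bit v (suc (2 * i)) p , bit v (2 * i) (<⇒≤ p))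
    pairs′ zero le p = pair₀
    pairs′ (suc i) le p =
      subst₂ _∼_ (cong₂ _,_ (bit-cong u idx₁ p′ p) (bit-cong u idx₀ (<⇒≤ p′) (<⇒≤ p)))
                 (cong₂ _,_ (bit-cong v idx₁ p′ p) (bit-cong v idx₀ (<⇒≤ p′) (<⇒≤ p)))
                 (pairs i (s≤s⁻¹ (s≤s⁻¹ (subst (_≤ suc (suc x)) (cong (_+ 2) (*-suc 2 i)) le))) q)
      where
        idx₀ = sym (*-suc 2 i)
        idx₁ = cong suc idx₀
        p′ = subst (_< suc (suc n)) (sym idx₁) p
        q  = s<s⁻¹ (s<s⁻¹ p′)

move : ∀ {n} → ℕ → Vertex n → Vertex n
move zero          u zero          = not (u zero)
move zero          u (suc i)       = u (suc i)
move (suc zero)    u zero          = u zero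
move (suc zero)    u (suc zero)    = not (u (suc zero))
move (suc zero)    u (suc (suc i)) = u (suc (suc i))
move (suc (suc x)) u zero          = u zero
move (suc (suc x)) u (suc zero)    = u zero xor u (suc zero)
move (suc (suc x)) u (suc (suc i)) = move x (drop₂ u) i

move-adjacent : ∀ {n} x (u : Vertex n) → x < n → AdjAt n u (move x u) x
move-adjacent {suc n} zero u x<n = record
  { x<n   = x<n
  ; diff  = λ e → not-¬ refl (sym e)
  ; odd   = λ j ()
  ; above = λ { zero () _ ; (suc i) _ _ → refl }
  ; pairs = λ i le → ⊥-elim (2≰0 (m+n≤o⇒n≤o (2 * i) le))
  }
  where
    2≰0 : ¬ 2 ≤ 0
    2≰0 ()
move-adjacent {suc (suc n)} (suc zero) u x<n = record
  { x<n   = x<n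
  ; diff  = λ e → not-¬ refl (sym e)
  ; odd   = λ { zero _ _ → refl ; (suc j) () _ }
  ; above = λ { (suc (suc i)) _ _ → refl ; (suc zero) (s≤s ()) _ }
  ; pairs = λ i le → ⊥-elim (2≰1 (m+n≤o⇒n≤o (2 * i) le))
  }
  where
    2≰1 : ¬ 2 ≤ 1
    2≰1 (s≤s ())
move-adjacent {suc (suc n)} (suc (suc x)) u x<n =
  AdjAt-shift (∼-xor (u (suc zero)) (u zero)) (move-adjacent x (drop₂ u) (s<s⁻¹ (s<s⁻¹ x<n)))
move-adjacent {suc zero} (suc x) u (s≤s ())

move-Adj : ∀ {n} (x : Fin n) (u : Vertex n) → Adj n u (move (toℕ x) u)
move-Adj x u = toℕ x , move-adjacent (toℕ x) u (toℕ<n x)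

extend : ∀ {m k} → Vertex m → Vertex (m + k) → Vertex (m + k)
extend {zero}  v u i       = u i
extend {suc m} v u zero    = v zero
extend {suc m} v u (suc i) = extend (λ j → v (suc j)) (λ j → u (suc j)) i

bit-extend-< : ∀ {m k} (v : Vertex m) (u : Vertex (m + k)) {j} (p : j < m) (q : j < m + k) →
               bit (extend v u) j q ≡ bit v j p
bit-extend-< {suc m} v u {zero}  p q = refl
bit-extend-< {suc m} v u {suc j} p q = bit-extend-< (λ i → v (suc i)) (λ i → u (suc i)) (s<s⁻¹ p) (s<s⁻¹ q)

bit-extend-≥ : ∀ {m k} (v : Vertex m) (u : Vertex (m + k)) {j} → m ≤ j → (q : j < m + k) →
               bit (extend v u) j q ≡ bit u j q
bit-extend-≥ {zero}  v u         _         q = refl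
bit-extend-≥ {suc m} v u {suc j} (s≤s m≤j) q =
  bit-extend-≥ (λ i → v (suc i)) (λ i → u (suc i)) m≤j (s<s⁻¹ q)

odd-bound : ∀ {x n} j → x ≡ suc (2 * j) → x < n → 2 * j < n
odd-bound {n = n} j e x<n = <⇒≤ (subst (_< n) e x<n)

pair-bound : ∀ {x n} i → 2 * i + 2 ≤ x → x < n → suc (2 * i) < n
pair-bound {x} i le x<n = ≤-trans (subst (_≤ x) (+-comm (2 * i) 2) le) (<⇒≤ x<n)

module _ {m k : ℕ} (u : Vertex (m + k)) where

  private
    lift : ∀ {j} → j < m → j < m + k
    lift p = <-≤-trans p (m≤m+n m k)

    low : ∀ (v : Vertex m) {j} (p : j < m) (q : j < m + k) → bit (extend v u) j q ≡ bit v j p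
    low v = bit-extend-< v u

    high : ∀ (v : Vertex m) {j} → m ≤ j → (q : j < m + k) → bit (extend v u) j q ≡ bit u j q
    high v = bit-extend-≥ v u

  extend-preserves : ∀ {v v' : Vertex m} {x} → AdjAt m v v' x → AdjAt (m + k) (extend v u) (extend v' u) x
  extend-preserves {v} {v'} {x} a = record
    { x<n   = lift x<n
    ; diff  = λ e → diff (trans (sym (low v' x<n (lift x<n))) (trans e (low v x<n (lift x<n))))
    ; odd   = λ j e p → let q = odd-bound j e x<n in
                trans (low v' q p) (trans (odd j e q) (sym (low v q p)))
    ; above = above′
    ; pairs = λ i le p → let q = pair-bound i le x<n in
                subst₂ _∼_ (cong₂ _,_ (sym (low v q p)) (sym (low v (<⇒≤ q) (<⇒≤ p))))
                           (cong₂ _,_ (sym (low v' q p)) (sym (low v' (<⇒≤ q) (<⇒≤ p))))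
                           (pairs i le q)
    }
    where
      open AdjAt a

      above′ : ∀ i → x < i → (p : i < m + k) → bit (extend v' u) i p ≡ bit (extend v u) i p
      above′ i lt p with i <? m
      ... | yes i<m = trans (low v' i<m p) (trans (above i lt i<m) (sym (low v i<m p)))
      ... | no  i≮m = trans (high v' (≮⇒≥ i≮m) p) (sym (high v (≮⇒≥ i≮m) p))

  extend-reflects : ∀ {v v' : Vertex m} {x} → AdjAt (m + k) (extend v u) (extend v' u) x → AdjAt m v v' x
  extend-reflects {v} {v'} {x} a = record
    { x<n   = x<m
    ; diff  = λ e → diff (trans (low v' x<m x<n) (trans e (sym (low v x<m x<n))))
    ; odd   = λ j e p → trans (sym (low v' p (lift p))) (trans (odd j e (lift p)) (low v p (lift p)))
    ; above = λ i lt p → trans (sym (low v' p (lift p))) (trans (above i lt (lift p)) (low v p (lift p)))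
    ; pairs = λ i le p →
                subst₂ _∼_ (cong₂ _,_ (low v p (lift p)) (low v (<⇒≤ p) (<⇒≤ (lift p))))
                           (cong₂ _,_ (low v' p (lift p)) (low v' (<⇒≤ p) (<⇒≤ (lift p))))
                           (pairs i le (lift p))
    }
    where
      open AdjAt a

      x<m : x < m
      x<m with x <? m
      ... | yes x<m = x<m
      ... | no  x≮m = ⊥-elim (diff (trans (high v' (≮⇒≥ x≮m) x<n) (sym (high v (≮⇒≥ x≮m) x<n))))

  extend-Adj : ∀ {v v' : Vertex m} → Adj m v v' → Adj (m + k) (extend v u) (extend v' u)
  extend-Adj (x , a) = x , extend-preserves a

  extend-Adj⁻ : ∀ {v v' : Vertex m} → Adj (m + k) (extend v u) (extend v' u) → Adj m v v'
  extend-Adj⁻ (x , a) = x , extend-reflects a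

module RichStructure {V : Set} (E : V → V → Set) where

  -- Inequality witnessed through adjacency, so that maps preserving and reflecting
  -- adjacency transport it: vertices are functions, and an automorphism is only a
  -- bijection up to propositional equality, not pointwise equality.
  record Separated (x y : V) : Set where
    constructor separated
    field
      witness     : V
      adjacent    : E witness x
      nonadjacent : ¬ E witness y

  record Square (v w : V) : Set where
    constructor square
    field
      p q   : V
      w-p   : E w p
      p-q   : E p q
      q-v   : E q v
      p≠v   : Separated p v
      q≠w   : Separated q w

  record RichEdge (v w : V) : Set where
    constructor rich
    field
      edge          : E v w
      first second  : Square v w
      apart         : Separated (Square.q first) (Square.q second)

  record RichPentagon (u : V) : Set where
    constructor pentagon
    field
      a b c d : V
      u-a : RichEdge u a
      a-b : RichEdge a b
      b-c : RichEdge b c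
      c-d : RichEdge c d
      d-u : RichEdge d u

open RichStructure

module _ {V W : Set} {E : V → V → Set} {F : W → W → Set} (h : V → W)
         (preserves : ∀ {x y} → E x y → F (h x) (h y))
         (reflects  : ∀ {x y} → F (h x) (h y) → E x y) where

  Separated-map : ∀ {x y} → Separated E x y → Separated F (h x) (h y)
  Separated-map (separated r rx ¬ry) = separated (h r) (preserves rx) (¬ry ∘ reflects)

  Square-map : ∀ {v w} → Square E v w → Square F (h v) (h w)
  Square-map (square p q wp pq qv p≠v q≠w) =
    square (h p) (h q) (preserves wp) (preserves pq) (preserves qv) (Separated-map p≠v) (Separated-map q≠w)

  RichEdge-map : ∀ {v w} → RichEdge E v w → RichEdge F (h v) (h w)
  RichEdge-map (rich vw s s' apart) = rich (preserves vw) (Square-map s) (Square-map s') (Separated-map apart)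

  RichPentagon-map : ∀ {u} → RichPentagon E u → RichPentagon F (h u)
  RichPentagon-map (pentagon a b c d ua ab bc cd du) =
    pentagon (h a) (h b) (h c) (h d)
      (RichEdge-map ua) (RichEdge-map ab) (RichEdge-map bc) (RichEdge-map cd) (RichEdge-map du)

module _ {n : ℕ} where

  Separated-respʳ : ∀ {x y y'} → y ≈ y' → Separated (Adj n) x y → Separated (Adj n) x y'
  Separated-respʳ e (separated r rx ¬ry) = separated r rx (¬ry ∘ Adj-resp ≈-refl (≈-sym e))

  Separated⇒≉ : ∀ {x y} → Separated (Adj n) x y → ¬ x ≈ y
  Separated⇒≉ (separated r rx ¬ry) e = ¬ry (Adj-resp ≈-refl e rx)

  Square-resp : ∀ {v v' w w'} → v ≈ v' → w ≈ w' → Square (Adj n) v w → Square (Adj n) v' w'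
  Square-resp ev ew (square p q wp pq qv p≠v q≠w) =
    square p q (Adj-resp ew ≈-refl wp) pq (Adj-resp ≈-refl ev qv)
      (Separated-respʳ ev p≠v) (Separated-respʳ ew q≠w)

  RichEdge-resp : ∀ {v v' w w'} → v ≈ v' → w ≈ w' → RichEdge (Adj n) v w → RichEdge (Adj n) v' w'
  RichEdge-resp ev ew (rich vw s s' apart) =
    rich (Adj-resp ev ew vw) (Square-resp ev ew s) (Square-resp ev ew s') apart

  RichPentagon-resp : ∀ {u u'} → u ≈ u' → RichPentagon (Adj n) u → RichPentagon (Adj n) u'
  RichPentagon-resp e (pentagon a b c d ua ab bc cd du) =
    pentagon a b c d (RichEdge-resp e ≈-refl ua) ab bc cd (RichEdge-resp ≈-refl e du)

module _ {k : ℕ} where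

  private
    N : ℕ
    N = suc (suc k)

  record Flip₀ (v w : Vertex N) : Set where
    constructor flip₀
    field
      bit₀  : w zero ≢ v zero
      bits₊ : ∀ i → w (suc i) ≡ v (suc i)

  record Flip₁ (v w : Vertex N) : Set where
    constructor flip₁
    field
      bit₀  : w zero ≡ v zero
      bit₁  : w (suc zero) ≢ v (suc zero)
      bits₊ : ∀ i → w (suc (suc i)) ≡ v (suc (suc i))

  data EdgeKind (v w : Vertex N) : Set where
    dim0  : Flip₀ v w → EdgeKind v w
    dim1  : Flip₁ v w → EdgeKind v w
    dim≥2 : w zero ≡ v zero → w (suc zero) ≡ v zero xor v (suc zero) → EdgeKind v w

  edgeKind : ∀ {v w x} → AdjAt N v w x → EdgeKind v w
  edgeKind {x = zero} a =
    dim0 (flip₀ diff λ i → AdjAt-above a (suc i) (s≤s z≤n))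
    where open AdjAt a
  edgeKind {x = suc zero} a =
    dim1 (flip₁ (odd 0 refl (s≤s z≤n)) diff λ i → AdjAt-above a (suc (suc i)) (s≤s (s≤s z≤n)))
    where open AdjAt a
  edgeKind {x = suc (suc x)} a =
    let w₀ , w₁ = ∼⇒≡xor (AdjAt.pairs a 0 (s≤s (s≤s z≤n)) (s≤s (s≤s z≤n))) in dim≥2 w₀ w₁

  differ-at-0-and-above⇒¬Adj : ∀ {u v : Vertex N} j →
                               u zero ≢ v zero → u (suc j) ≢ v (suc j) → ¬ Adj N u v
  differ-at-0-and-above⇒¬Adj j d₀ d₊ (_ , a) with edgeKind a
  ... | dim0 (flip₀ _ v₊)    = d₊ (sym (v₊ j))
  ... | dim1 (flip₁ v₀ _ _)  = d₀ (sym v₀)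
  ... | dim≥2 v₀ _           = d₀ (sym v₀)

  Flip₀-sym : {v w : Vertex N} → Flip₀ v w → Flip₀ w v
  Flip₀-sym (flip₀ w₀ w₊) = flip₀ (w₀ ∘ sym) λ i → sym (w₊ i)

  Flip₀-unique : {v w w' : Vertex N} → Flip₀ v w → Flip₀ v w' → w ≈ w'
  Flip₀-unique (flip₀ w₀ w₊) (flip₀ w₀' w₊') zero = trans (¬-not w₀) (sym (¬-not w₀'))
  Flip₀-unique (flip₀ w₀ w₊) (flip₀ w₀' w₊') (suc i) = trans (w₊ i) (sym (w₊' i))

  Flip₁-sym : {v w : Vertex N} → Flip₁ v w → Flip₁ w v
  Flip₁-sym (flip₁ w₀ w₁ w₊) = flip₁ (sym w₀) (w₁ ∘ sym) λ i → sym (w₊ i)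

  Flip₁-unique : {v w w' : Vertex N} → Flip₁ v w → Flip₁ v w' → w ≈ w'
  Flip₁-unique (flip₁ w₀ w₁ w₊) (flip₁ w₀' w₁' w₊') zero = trans w₀ (sym w₀')
  Flip₁-unique (flip₁ w₀ w₁ w₊) (flip₁ w₀' w₁' w₊') (suc zero) = trans (¬-not w₁) (sym (¬-not w₁'))
  Flip₁-unique (flip₁ w₀ w₁ w₊) (flip₁ w₀' w₁' w₊') (suc (suc i)) = trans (w₊ i) (sym (w₊' i))


  -- Bit 0 changes an odd number of times along w p q v, so exactly one of the three
  -- edges has dimension 0; it cannot be the first or the last one, and a middle
  -- dimension-0 edge forces q to be v with bit 1 flipped.
  Flip₀-square : ∀ {v w p q : Vertex N} → Flip₀ v w →
                 Adj N w p → Adj N p q → Adj N q v → ¬ p ≈ v → ¬ q ≈ w → Flip₁ v q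
  Flip₀-square {v} {w} {p} {q} f@(flip₀ w₀ w₊) (_ , wp) (_ , pq) (_ , qv) p≉v q≉w =
    classify (edgeKind wp) (edgeKind pq) (edgeKind qv)
    where
      bit₀-kept : p zero ≡ w zero → q zero ≡ p zero → v zero ≡ q zero → Flip₁ v q
      bit₀-kept p₀ q₀ v₀ = ⊥-elim (w₀ (sym (trans v₀ (trans q₀ p₀))))

      classify : EdgeKind w p → EdgeKind p q → EdgeKind q v → Flip₁ v q
      classify (dim0 f₁) _ _ = ⊥-elim (p≉v (Flip₀-unique f₁ (Flip₀-sym f)))
      classify _ _ (dim0 f₃) = ⊥-elim (q≉w (Flip₀-unique (Flip₀-sym f₃) f))
      classify _ _ (dim1 f₃) = Flip₁-sym f₃
      classify (dim1 (flip₁ _ p₁ p₊)) (dim0 (flip₀ _ q₊)) (dim≥2 v₀ _) =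
        flip₁ (sym v₀) (λ e → p₁ (trans (sym (q₊ zero)) (trans e (sym (w₊ zero)))))
          λ i → trans (q₊ (suc i)) (trans (p₊ i) (w₊ (suc i)))
      classify (dim≥2 p₀ p₁) (dim0 (flip₀ _ q₊)) (dim≥2 v₀ v₁) =
        ⊥-elim (not-¬ refl (begin
          v (suc zero)                                  ≡⟨ v₁ ⟩
          q zero xor q (suc zero)                       ≡⟨ cong₂ _xor_ (sym v₀) (q₊ zero) ⟩
          v zero xor p (suc zero)                       ≡⟨ cong (v zero xor_) p₁ ⟩
          v zero xor (w zero xor w (suc zero))
            ≡⟨ cong₂ (λ a b → v zero xor (a xor b)) (¬-not w₀) (w₊ zero) ⟩
          v zero xor (not (v zero) xor v (suc zero))    ≡⟨ xor-not-xor (v zero) (v (suc zero)) ⟩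
          not (v (suc zero))                            ∎))
        where open ≡-Reasoning
      classify (dim1 (flip₁ p₀ _ _)) (dim1 (flip₁ q₀ _ _)) (dim≥2 v₀ _) = bit₀-kept p₀ q₀ v₀
      classify (dim1 (flip₁ p₀ _ _)) (dim≥2 q₀ _) (dim≥2 v₀ _) = bit₀-kept p₀ q₀ v₀
      classify (dim≥2 p₀ _) (dim1 (flip₁ q₀ _ _)) (dim≥2 v₀ _) = bit₀-kept p₀ q₀ v₀
      classify (dim≥2 p₀ _) (dim≥2 q₀ _) (dim≥2 v₀ _) = bit₀-kept p₀ q₀ v₀

  Flip₀⇒¬RichEdge : {v w : Vertex N} → Flip₀ v w → ¬ RichEdge (Adj N) v w
  Flip₀⇒¬RichEdge f (rich _ (square _ _ wp pq qv p≠v q≠w) (square _ _ wp' pq' qv' p≠v' q≠w') apart) =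
    Separated⇒≉ apart (Flip₁-unique
      (Flip₀-square f wp pq qv (Separated⇒≉ p≠v) (Separated⇒≉ q≠w))
      (Flip₀-square f wp' pq' qv' (Separated⇒≉ p≠v') (Separated⇒≉ q≠w')))

  RichEdge-from-odd : {v w : Vertex N} → Odd v → RichEdge (Adj N) v w →
                      Odd w × w (suc zero) ≡ not (v (suc zero))
  RichEdge-from-odd {v} v₀ r@(rich (_ , vw) _ _ _) with edgeKind vw
  ... | dim0 f               = ⊥-elim (Flip₀⇒¬RichEdge f r)
  ... | dim1 (flip₁ w₀ w₁ _) = trans w₀ v₀ , ¬-not w₁
  ... | dim≥2 w₀ w₁          = trans w₀ v₀ , trans w₁ (cong (λ b → b xor v (suc zero)) v₀)

  Odd⇒¬RichPentagon : {u : Vertex N} → Odd u → ¬ RichPentagon (Adj N) u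
  Odd⇒¬RichPentagon {u} u₀ (pentagon a b c d ua ab bc cd du)
    with a₀ , a₁ ← RichEdge-from-odd u₀ ua
    with b₀ , b₁ ← RichEdge-from-odd a₀ ab
    with c₀ , c₁ ← RichEdge-from-odd b₀ bc
    with d₀ , d₁ ← RichEdge-from-odd c₀ cd
    with _  , u₁ ← RichEdge-from-odd d₀ du =
    not⁵-fixpoint-free (u (suc zero))
      (trans u₁ (cong not (trans d₁ (cong not (trans c₁ (cong not (trans b₁ (cong not a₁))))))))

_≈?_ : ∀ {n} (u v : Vertex n) → Dec (u ≈ v)
u ≈? v = all? (λ i → u i Bool.≟ v i)

∀-Bool? : {P : Bool → Set} → ((b : Bool) → Maybe (P b)) → Maybe (∀ b → P b)
∀-Bool? f = do
  p-false ← f false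
  p-true  ← f true
  just λ { false → p-false ; true → p-true }

firstJust : ∀ {n} {A : Set} → (Fin n → Maybe A) → Maybe A
firstJust {n} f = head (mapMaybe f (allFin n))

nonadjacent? : ∀ {k} (u v : Vertex (suc (suc k))) → Maybe (¬ Adj (suc (suc k)) u v)
nonadjacent? u v = do
  d₀       ← dec⇒maybe (¬? (u zero Bool.≟ v zero))
  (j , d₊) ← dec⇒maybe (any? λ j → ¬? (u (suc j) Bool.≟ v (suc j)))
  just (differ-at-0-and-above⇒¬Adj j d₀ d₊)

module CQ₅ where

  V : Set
  V = Vertex 5

  adjacent? : (x : Fin 5) (u v : V) → Maybe (Adj 5 u v)
  adjacent? x u v = do
    e ← dec⇒maybe (v ≈? move (toℕ x) u)
    just (Adj-resp ≈-refl (≈-sym e) (move-Adj x u))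

  separated? : (x y : V) → Maybe (Separated (Adj 5) x y)
  separated? x y = do
    r≁y ← nonadjacent? r y
    just (separated r (0 , AdjAt-sym (move-adjacent 0 x (s≤s z≤n))) r≁y)
    where
      r = move 0 x

  square? : (d : Fin 5) (v : V) (a : Fin 5) → Maybe (Square (Adj 5) v (move (toℕ d) v))
  square? d v a = do
    q-v ← adjacent? a q v
    p≠v ← separated? p v
    q≠w ← separated? q w
    just (square p q (move-Adj a w) (move-Adj d p) q-v p≠v q≠w)
    where
      w = move (toℕ d) v
      p = move (toℕ a) w
      q = move (toℕ d) p

  richEdge? : (d : Fin 5) (v : V) → Maybe (RichEdge (Adj 5) v (move (toℕ d) v))
  richEdge? d v = firstJust λ a → firstJust λ a' → do
    s     ← square? d v a
    s'    ← square? d v a'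
    apart ← separated? (Square.q s) (Square.q s')
    just (rich (move-Adj d v) s s' apart)

  richPentagon? : (u : V) → Maybe (RichPentagon (Adj 5) u)
  richPentagon? u = do
    u-a ← richEdge? (# 2) u
    a-b ← richEdge? (# 3) a
    b-c ← richEdge? (# 4) b
    c-d ← richEdge? (# 2) c
    d-u ← richEdge? (# 4) d
    e   ← dec⇒maybe (move 4 d ≈? u)
    just (pentagon a b c d u-a a-b b-c c-d (RichEdge-resp ≈-refl e d-u))
    where
      a = move 2 u
      b = move 3 a
      c = move 4 b
      d = move 2 c

  evenVertex : Bool → Bool → Bool → Bool → V
  evenVertex b₁ b₂ b₃ b₄ = lookup (false ∷ b₁ ∷ b₂ ∷ b₃ ∷ b₄ ∷ [])

  evenVertex-RichPentagon : ∀ b₁ b₂ b₃ b₄ → RichPentagon (Adj 5) (evenVertex b₁ b₂ b₃ b₄)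
  evenVertex-RichPentagon =
    from-just (∀-Bool? λ b₁ → ∀-Bool? λ b₂ → ∀-Bool? λ b₃ → ∀-Bool? λ b₄ → richPentagon? (evenVertex b₁ b₂ b₃ b₄))

Even⇒RichPentagon : ∀ {k} {u : Vertex (5 + k)} → Even u → RichPentagon (Adj (5 + k)) u
Even⇒RichPentagon {k} {u} u₀ =
  RichPentagon-resp low-bits-kept
    (RichPentagon-map (λ v → extend v u) (extend-Adj u) (extend-Adj⁻ u)
      (CQ₅.evenVertex-RichPentagon u₁ u₂ u₃ u₄))
  where
    u₁ = u (# 1)
    u₂ = u (# 2)
    u₃ = u (# 3)
    u₄ = u (# 4)

    low-bits-kept : extend (CQ₅.evenVertex u₁ u₂ u₃ u₄) u ≈ u
    low-bits-kept zero                                = sym u₀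
    low-bits-kept (suc zero)                          = refl
    low-bits-kept (suc (suc zero))                    = refl
    low-bits-kept (suc (suc (suc zero)))              = refl
    low-bits-kept (suc (suc (suc (suc zero))))        = refl
    low-bits-kept (suc (suc (suc (suc (suc i)))))     = refl

module _ {n} (A : Automorphism n) where

  open Automorphism A using (to; preserves)
  open Inverse (⤖⇒↔ (Automorphism.φ A)) using (from; strictlyInverseˡ; strictlyInverseʳ)

  RichPentagon-to : ∀ {u} → RichPentagon (Adj n) u → RichPentagon (Adj n) (to u)
  RichPentagon-to = RichPentagon-map to (proj₁ (preserves _ _)) (proj₂ (preserves _ _))

  RichPentagon-from : ∀ {u} → RichPentagon (Adj n) (to u) → RichPentagon (Adj n) u
  RichPentagon-from {u} r =
    subst (RichPentagon (Adj n)) (strictlyInverseʳ u) (RichPentagon-map from from-Adj from-Adj⁻ r)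
    where
      from-Adj : ∀ {x y} → Adj n x y → Adj n (from x) (from y)
      from-Adj {x} {y} a =
        proj₂ (preserves _ _) (subst₂ (Adj n) (sym (strictlyInverseˡ x)) (sym (strictlyInverseˡ y)) a)

      from-Adj⁻ : ∀ {x y} → Adj n (from x) (from y) → Adj n x y
      from-Adj⁻ {x} {y} a = subst₂ (Adj n) (strictlyInverseˡ x) (strictlyInverseˡ y) (proj₁ (preserves _ _) a)

lemma13 : (m : ℕ) → 5 ≤ suc m → (A : Automorphism (suc m)) →
          (∀ u → (Odd u → Odd (Automorphism.to A u)) ×
                 (Even u → Even (Automorphism.to A u)))
lemma13 (suc (suc (suc (suc k)))) _ A u = odd-kept , even-kept
  where
    odd-kept : Odd u → Odd (Automorphism.to A u)
    odd-kept u₀ = ¬-not λ e → Odd⇒¬RichPentagon u₀ (RichPentagon-from A (Even⇒RichPentagon e))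

    even-kept : Even u → Even (Automorphism.to A u)
    even-kept u₀ = ¬-not λ e → Odd⇒¬RichPentagon e (RichPentagon-to A (Even⇒RichPentagon u₀))
lemma13 zero                      (s≤s ())
lemma13 (suc zero)                (s≤s (s≤s ()))
lemma13 (suc (suc zero))          (s≤s (s≤s (s≤s ())))
lemma13 (suc (suc (suc zero)))    (s≤s (s≤s (s≤s (s≤s ()))))
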